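{- Let $\sigma=\sigma_1\sigma_2\cdots\sigma_k$ be a Cayley permutation with $k\ge 2$ and $\sigma\neq 12$, and let $\hat{\sigma}=\sigma_2\sigma_1\sigma_3\cdots\sigma_k$. If $\hat{\sigma}$ avoids $231$, then $\mathrm{Sort}(\sigma)$ is not a class.
   Context: A Cayley permutation is a finite word $\pi=\pi_1\cdots\pi_n$ over the positive integers such that every integer from $1$ to $\max(\pi)$ occurs at least once; $\mathcal{C}$ denotes the set of all Cayley permutations. A word $x=x_1\cdots x_n$ contains a pattern $p=p_1\cdots p_k$ if there are indices $i_1<\cdots<i_k$ such that for all $u,v$: $x_{i_u}<x_{i_v}$ iff $p_u<p_v$, and $x_{i_u}=x_{i_v}$ iff $p_u=p_v$; otherwise $x$ avoids $p$. A class is a subset of $\mathcal{C}$ closed downwards under pattern containment (if $\pi$ is in the set and $\pi$ contains $\tau\in\mathcal{C}$, then $\tau$ is in the set). For a Cayley permutation $\tau$ of length at least two, a $\tau$-stack processes an input word from left to right with the following right-greedy algorithm: while the input is nonempty, if pushing the next input element onto the stack yields stack contents which, read from top to bottom, avoid $\tau$, the element is pushed; otherwise the top element of the stack is popped and appended to the output. When the input is exhausted, the remaining elements are popped one by one. Denote by $s_\tau(\pi)$ the output of the $\tau$-stack on input $\pi$. The $\sigma$-machine consists of a $\sigma$-stack followed in series by a $21$-stack: $s_\sigma(\pi)$ is used as input of a $21$-stack operated by the same algorithm with $\tau=21$. A Cayley permutation $\pi$ is $\sigma$-sortable if the final output of the $\sigma$-machine on input $\pi$ is weakly increasing; $\mathrm{Sort}(\sigma)$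 denotes the set of $\sigma$-sortable Cayley permutations. -}

module Defs where

open import Data.Nat using (ℕ; zero; suc; _≤_; _<ᵇ_; _≡ᵇ_; _⊔_)
open import Data.Bool using (Bool; true; false; _∧_; not; if_then_else_)
open import Data.Bool.Properties using () renaming (_≟_ to _≟ᵇ_)
open import Data.List using (List; []; _∷_; _++_; map; zip; foldr; length)
open import Data.Bool.ListAction using (all; any)
open import Data.List.Membership.Propositional using (_∈_)
open import Data.List.Relation.Unary.Linked using (Linked)
open import Data.Product using (_×_; _,_)
open import Relation.Binary.PropositionalEquality using (_≡_)
open import Relation.Nullary using (¬_)
open import Relation.Nullary.Decidable using (⌊_⌋)

Word : Set
Word = List ℕ

maxW : Word → ℕ
maxW = foldr _⊔_ 0

IsCayley : Word → Set
IsCayley π = (∀ {x} → x ∈ π → 1 ≤ x) × (∀ i → 1 ≤ i → i ≤ maxW π → i ∈ π)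

subsequences : Word → List Word
subsequences [] = [] ∷ []
subsequences (x ∷ xs) = map (x ∷_) (subsequences xs) ++ subsequences xs

_==_ : Bool → Bool → Bool
a == b = ⌊ a ≟ᵇ b ⌋

orderIso : Word → Word → Bool
orderIso w p = ⌊ length w Data.Nat.≟ length p ⌋ ∧ all (λ a → all (λ b → ok a b) z) z
  where
  z = zip w p
  ok : ℕ × ℕ → ℕ × ℕ → Bool
  ok (wu , pu) (wv , pv) = ((wu <ᵇ wv) == (pu <ᵇ pv)) ∧ ((wu ≡ᵇ wv) == (pu ≡ᵇ pv))

contains : Word → Word → Bool
contains x p = any (λ w → orderIso w p) (subsequences x)

Contains : Word → Word → Set
Contains x p = contains x p ≡ true

Avoids : Word → Word → Set
Avoids x p = ¬ Contains x p

-- The τ-stack (right-greedy). The stack is a list whose head is the top,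
-- so the stack read top to bottom is the list itself.
-- stackRun τ input stack = output produced from this configuration.
mutual
  stackRun : Word → Word → Word → Word
  stackRun τ [] st = st
  stackRun τ (x ∷ xs) st = step τ x xs st

  step : Word → ℕ → Word → Word → Word
  step τ x xs [] = stackRun τ xs (x ∷ [])      -- push (a single element never contains τ, |τ| ≥ 2)
  step τ x xs (y ∷ st) =
    if not (contains (x ∷ y ∷ st) τ)
      then stackRun τ xs (x ∷ y ∷ st)
      else y ∷ step τ x xs st

s : Word → Word → Word
s τ π = stackRun τ π []

machine : Word → Word → Word
machine σ π = s (2 ∷ 1 ∷ []) (s σ π)

WeaklyIncreasing : Word → Set
WeaklyIncreasing = Linked _≤_

Sortable : Word → Word → Set
Sortable σ π = WeaklyIncreasing (machine σ π)

Sort : Word → Word → Set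
Sort σ π = IsCayley π × Sortable σ π

IsClass : (Word → Set) → Set
IsClass S = (∀ π → S π → IsCayley π) ×
            (∀ π τ → S π → IsCayley τ → Contains π τ → S τ)

hat : Word → Word
hat (a ∷ b ∷ rest) = b ∷ a ∷ rest
hat w = w

module Submission where

-- For σ ∈ {11, 21, 231}, explicit words show that Sort(σ) is not closed under patterns. Otherwise
-- |σ| ≥ 3 and σ is not a pattern of 231, so the σ-stack turns 132 into 231, which a 21-stack cannot
-- sort. Yet 132 is a pattern of a σ-sortable π, built from a copy of σ shifted up by one or two and the
-- small entries 1 (and 2), on which the σ-stack outputs the shifted σ̂ with the small entries inserted
-- where they cannot belong to a 231. As σ̂ avoids 231, so does this output, and a 21-stack sorts every
-- 231-avoiding word.

open import Defs
open import Data.Bool using (true; false; T; _∧_)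
open import Data.Bool.Properties using (T-≡; T-∧; ¬-not) renaming (_≟_ to _≟ᵇ_)
open import Data.Empty using (⊥-elim)
open import Data.List using (List; []; _∷_; _++_; map; zip; length; reverse; _ʳ++_; applyUpTo)
open import Data.List.Properties using (length-map; length-reverse; reverse-involutive; ++-identityʳ)
open import Data.List.Membership.Propositional using (_∈_; lose; find)
open import Data.List.Membership.Propositional.Properties
  using (∈-applyUpTo⁺; ∈-applyUpTo⁻; ∈-map⁺; ∈-map⁻; ∈-++⁺ˡ; ∈-++⁺ʳ; ∈-++⁻)
open import Data.List.Relation.Binary.Equality.Propositional using (≋⇒≡)
open import Data.List.Relation.Binary.Permutation.Propositional
  using (_↭_; prep; swap; ↭-refl; ↭-reflexive; ↭-sym; ↭-trans)
open import Data.List.Relation.Binary.Permutation.Propositional.Properties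
  using (shift; ∈-resp-↭; ↭-reverse) renaming (++⁺ʳ to ↭-++⁺ʳ; ++-comm to ↭-++-comm)
open import Data.List.Relation.Binary.Sublist.Propositional
  using (_⊆_; []; _∷_; _∷ʳ_; ⊆-refl; ⊆-trans; to∈; from∈; minimum)
open import Data.List.Relation.Binary.Sublist.Propositional.Properties
  using (length-mono-≤; to-≋; ʳ++⁺; ++⁺ˡ; ∷ˡ⁻; reverse⁺) renaming (++⁺ to ⊆-++⁺)
open import Data.List.Relation.Unary.All as All using (All)
open import Data.List.Relation.Unary.All.Properties using (all⁺; all⁻; applyUpTo⁺₁; applyUpTo⁻; map⁺)
open import Data.List.Relation.Unary.AllPairs as AllPairs using (AllPairs; _∷_)
open import Data.List.Relation.Unary.Any using (here; there)
open import Data.List.Relation.Unary.Any.Properties using (any⁺; any⁻)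
open import Data.List.Relation.Unary.Linked as Linked using (Linked; [-]; _∷_; linked?)
open import Data.List.Relation.Unary.Linked.Properties using (Linked⇒AllPairs)
open import Data.Nat using (ℕ; zero; suc; _+_; _∸_; _≤_; _<_; _≥_; _<ᵇ_; _≡ᵇ_; _≟_; s≤s; z≤n; s≤s⁻¹)
open import Data.Nat.Properties
  using ( _≤?_; _<?_; ≤-refl; ≤-reflexive; ≤-trans; <-irrefl; <-asym; <-trans; ≤-<-trans; <⇒≤; <⇒≢; <⇒≱
        ; ≰⇒>; ≮⇒≥; m≤m+n; m≤n+m; +-suc; +-identityʳ; +-monoʳ-≤; m+[n∸m]≡n; m<n⇒0<n∸m; m≤n+o⇒m∸n≤o
        ; m≤m⊔n; m≤n⊔m; ⊔-lub; <ᵇ⇒<; <⇒<ᵇ; ≡ᵇ⇒≡; ≡⇒≡ᵇ)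
open import Data.List.Membership.DecPropositional _≟_ using (_∈?_)
open import Data.Product using (_×_; _,_; proj₁; proj₂; ∃-syntax)
open import Data.Sum as Sum using (_⊎_; inj₁; inj₂)
open import Function using (_∘_; flip; _⇔_; mk⇔; Equivalence)
open import Relation.Binary.PropositionalEquality
  using (_≡_; _≢_; refl; sym; trans; subst; cong; module ≡-Reasoning)
open import Relation.Nullary using (¬_; yes; no; Dec)
open import Relation.Nullary.Decidable
  using (⌊_⌋; True; False; toWitness; toWitnessFalse; fromWitness; map′; _×-dec_)

open Equivalence

∈-subsequences⁺ : ∀ {u w : Word} → u ⊆ w → u ∈ subsequences w
∈-subsequences⁺ [] = here refl
∈-subsequences⁺ (_∷ʳ_ {ys = w} x u⊆w) = ∈-++⁺ʳ (map (x ∷_) (subsequences w)) (∈-subsequences⁺ u⊆w)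
∈-subsequences⁺ (refl ∷ u⊆w) = ∈-++⁺ˡ (∈-map⁺ _ (∈-subsequences⁺ u⊆w))

∈-subsequences⁻ : ∀ {u : Word} w → u ∈ subsequences w → u ⊆ w
∈-subsequences⁻ [] (here refl) = []
∈-subsequences⁻ (x ∷ w) u∈ with ∈-++⁻ (map (x ∷_) (subsequences w)) u∈
... | inj₁ u∈map with _ , v∈ , refl ← ∈-map⁻ (x ∷_) u∈map = refl ∷ ∈-subsequences⁻ w v∈
... | inj₂ u∈rest = x ∷ʳ ∈-subsequences⁻ w u∈rest

contains⁺ : ∀ {u w p} → u ⊆ w → orderIso u p ≡ true → Contains w p
contains⁺ u⊆w iso = T-≡ .to (any⁺ _ (lose (∈-subsequences⁺ u⊆w) (T-≡ .from iso)))

contains⁻ : ∀ {w p} → Contains w p → ∃[ u ] u ⊆ w × orderIso u p ≡ true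
contains⁻ {w} c with u , u∈ , iso ← find (any⁻ _ _ (T-≡ .from c)) = u , ∈-subsequences⁻ w u∈ , T-≡ .to iso

orderIso⇒length≡ : ∀ {u p} → orderIso u p ≡ true → length u ≡ length p
orderIso⇒length≡ {u} {p} iso = toWitness (T-∧ {⌊ length u ≟ length p ⌋} .to (T-≡ .from iso) .proj₁)

orderIso⇒<ᵇ≡ : ∀ {u p x y a b} → orderIso u p ≡ true → (x , a) ∈ zip u p → (y , b) ∈ zip u p →
               (x <ᵇ y) ≡ (a <ᵇ b)
orderIso⇒<ᵇ≡ {u} {p} {x} {y} {a} {b} iso xa yb =
  toWitness (T-∧ {(x <ᵇ y) == (a <ᵇ b)} .to
    (All.lookup (all⁺ _ _ (All.lookup (all⁺ _ _ (T-∧ {⌊ length u ≟ length p ⌋} .to (T-≡ .from iso) .proj₂)) xa)) yb)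
    .proj₁)

orderIso⇒<⇔ : ∀ {u p x y a b} → orderIso u p ≡ true → (x , a) ∈ zip u p → (y , b) ∈ zip u p → x < y ⇔ a < b
orderIso⇒<⇔ {u} {p} {x} {y} {a} {b} iso xa yb =
  mk⇔ (λ x<y → <ᵇ⇒< a b (subst T x<y≡a<b (<⇒<ᵇ x<y))) (λ a<b → <ᵇ⇒< x y (subst T (sym x<y≡a<b) (<⇒<ᵇ a<b)))
  where
  x<y≡a<b : (x <ᵇ y) ≡ (a <ᵇ b)
  x<y≡a<b = orderIso⇒<ᵇ≡ {u} {p} iso xa yb

contains⇒length≤ : ∀ {w p} → Contains w p → length p ≤ length w
contains⇒length≤ {w} {p} c with u , u⊆w , iso ← contains⁻ {w} {p} c =
  ≤-trans (≤-reflexive (sym (orderIso⇒length≡ {u} {p} iso))) (length-mono-≤ u⊆w)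

contains-short : ∀ {w p} → length w < length p → contains w p ≡ false
contains-short {w} {p} w<p = ¬-not λ c → <⇒≱ w<p (contains⇒length≤ {w} {p} c)

contains-sameLength⇒orderIso : ∀ {w p} → length w ≡ length p → Contains w p → orderIso w p ≡ true
contains-sameLength⇒orderIso {w} {p} w≡p c with u , u⊆w , iso ← contains⁻ {w} {p} c =
  subst (λ v → orderIso v p ≡ true) (≋⇒≡ (to-≋ (trans (orderIso⇒length≡ {u} {p} iso) (sym w≡p)) u⊆w)) iso

contains-sameLength⇒head<⇔ : ∀ {x y a b w p} → length w ≡ length p → Contains (x ∷ y ∷ w) (a ∷ b ∷ p) →
                             x < y ⇔ a < b
contains-sameLength⇒head<⇔ {x} {y} {a} {b} {w} {p} w≡p c =
  orderIso⇒<⇔ {x ∷ y ∷ w} {a ∷ b ∷ p} iso (here refl) (there (here refl))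
  where
  iso : orderIso (x ∷ y ∷ w) (a ∷ b ∷ p) ≡ true
  iso = contains-sameLength⇒orderIso {x ∷ y ∷ w} {a ∷ b ∷ p} (cong (suc ∘ suc) w≡p) c

==-refl : ∀ b → T (b == b)
==-refl b = fromWitness {a? = b ≟ᵇ b} refl

zip-map-diagonal : ∀ (f : ℕ → ℕ) w {q} → q ∈ zip (map f w) w → ∃[ x ] q ≡ (f x , x)
zip-map-diagonal f (x ∷ w) (here refl) = x , refl
zip-map-diagonal f (x ∷ w) (there q∈) = zip-map-diagonal f w q∈

orderIso-map : ∀ (f : ℕ → ℕ) → (∀ x y → (f x <ᵇ f y) ≡ (x <ᵇ y)) → (∀ x y → (f x ≡ᵇ f y) ≡ (x ≡ᵇ y)) →
               ∀ w → orderIso (map f w) w ≡ true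
orderIso-map f f-<ᵇ f-≡ᵇ w =
  T-≡ .to (T-∧ {⌊ length (map f w) ≟ length w ⌋} .from (fromWitness (length-map f w) ,
    all⁻ _ {zip (map f w) w} (All.tabulate λ { {_ , _} q∈ →
      all⁻ _ {zip (map f w) w} (All.tabulate λ { {_ , _} r∈ → agree q∈ r∈ }) })))
  where
  agree : ∀ {x₁ x₂ y₁ y₂} → (x₁ , x₂) ∈ zip (map f w) w → (y₁ , y₂) ∈ zip (map f w) w →
          T (((x₁ <ᵇ y₁) == (x₂ <ᵇ y₂)) ∧ ((x₁ ≡ᵇ y₁) == (x₂ ≡ᵇ y₂)))
  agree q∈ r∈ with x , refl ← zip-map-diagonal f w q∈ | y , refl ← zip-map-diagonal f w r∈
    rewrite f-<ᵇ x y | f-≡ᵇ x y = T-∧ {(x <ᵇ y) == (x <ᵇ y)} .from (==-refl (x <ᵇ y) , ==-refl (x ≡ᵇ y))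

+-<ᵇ : ∀ k x y → (k + x <ᵇ k + y) ≡ (x <ᵇ y)
+-<ᵇ zero x y = refl
+-<ᵇ (suc k) x y = +-<ᵇ k x y

+-≡ᵇ : ∀ k x y → (k + x ≡ᵇ k + y) ≡ (x ≡ᵇ y)
+-≡ᵇ zero x y = refl
+-≡ᵇ (suc k) x y = +-≡ᵇ k x y

orderIso-shift : ∀ k w → orderIso (map (k +_) w) w ≡ true
orderIso-shift k = orderIso-map (k +_) (+-<ᵇ k) (+-≡ᵇ k)

shift⊆⇒Contains : ∀ k p {w} → map (k +_) p ⊆ w → Contains w p
shift⊆⇒Contains k p p⁺⊆w = contains⁺ p⁺⊆w (orderIso-shift k p)

pat21 pat231 pat132 : Word
pat21 = 2 ∷ 1 ∷ []
pat231 = 2 ∷ 3 ∷ 1 ∷ []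
pat132 = 1 ∷ 3 ∷ 2 ∷ []

<ᵇ-irrefl : ∀ n → (n <ᵇ n) ≡ false
<ᵇ-irrefl n = ¬-not λ n<n → <-irrefl refl (<ᵇ⇒< n n (T-≡ .from n<n))

≡ᵇ-refl : ∀ n → (n ≡ᵇ n) ≡ true
≡ᵇ-refl n = T-≡ .to (≡⇒≡ᵇ n n refl)

module _ {m n : ℕ} (m<n : m < n) where

  <⇒<ᵇ≡true : (m <ᵇ n) ≡ true
  <⇒<ᵇ≡true = T-≡ .to (<⇒<ᵇ m<n)

  <⇒>ᵇ≡false : (n <ᵇ m) ≡ false
  <⇒>ᵇ≡false = ¬-not λ n<m → <-asym m<n (<ᵇ⇒< n m (T-≡ .from n<m))

  <⇒≡ᵇ≡false : (m ≡ᵇ n) ≡ false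
  <⇒≡ᵇ≡false = ¬-not λ m≡n → <⇒≢ m<n (≡ᵇ⇒≡ m n (T-≡ .from m≡n))

  <⇒≡ᵇ≡falseˡ : (n ≡ᵇ m) ≡ false
  <⇒≡ᵇ≡falseˡ = ¬-not λ n≡m → <⇒≢ m<n (sym (≡ᵇ⇒≡ n m (T-≡ .from n≡m)))

orderIso-21 : ∀ {x y} → y < x → orderIso (x ∷ y ∷ []) pat21 ≡ true
orderIso-21 {x} {y} y<x
  rewrite <ᵇ-irrefl x | <ᵇ-irrefl y | ≡ᵇ-refl x | ≡ᵇ-refl y
        | <⇒<ᵇ≡true y<x | <⇒>ᵇ≡false y<x | <⇒≡ᵇ≡false y<x | <⇒≡ᵇ≡falseˡ y<x = refl

orderIso-231 : ∀ {a b c} → c < a → a < b → orderIso (a ∷ b ∷ c ∷ []) pat231 ≡ true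
orderIso-231 {a} {b} {c} c<a a<b
  rewrite <ᵇ-irrefl a | <ᵇ-irrefl b | <ᵇ-irrefl c | ≡ᵇ-refl a | ≡ᵇ-refl b | ≡ᵇ-refl c
        | <⇒<ᵇ≡true a<b | <⇒>ᵇ≡false a<b | <⇒≡ᵇ≡false a<b | <⇒≡ᵇ≡falseˡ a<b
        | <⇒<ᵇ≡true c<a | <⇒>ᵇ≡false c<a | <⇒≡ᵇ≡false c<a | <⇒≡ᵇ≡falseˡ c<a
        | <⇒<ᵇ≡true (<-trans c<a a<b) | <⇒>ᵇ≡false (<-trans c<a a<b)
        | <⇒≡ᵇ≡false (<-trans c<a a<b) | <⇒≡ᵇ≡falseˡ (<-trans c<a a<b) = refl

orderIso-132 : ∀ {a b c} → a < c → c < b → orderIso (a ∷ b ∷ c ∷ []) pat132 ≡ true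
orderIso-132 {a} {b} {c} a<c c<b
  rewrite <ᵇ-irrefl a | <ᵇ-irrefl b | <ᵇ-irrefl c | ≡ᵇ-refl a | ≡ᵇ-refl b | ≡ᵇ-refl c
        | <⇒<ᵇ≡true a<c | <⇒>ᵇ≡false a<c | <⇒≡ᵇ≡false a<c | <⇒≡ᵇ≡falseˡ a<c
        | <⇒<ᵇ≡true c<b | <⇒>ᵇ≡false c<b | <⇒≡ᵇ≡false c<b | <⇒≡ᵇ≡falseˡ c<b
        | <⇒<ᵇ≡true (<-trans a<c c<b) | <⇒>ᵇ≡false (<-trans a<c c<b)
        | <⇒≡ᵇ≡false (<-trans a<c c<b) | <⇒≡ᵇ≡falseˡ (<-trans a<c c<b) = refl

step-push : ∀ {τ x xs} st → contains (x ∷ st) τ ≡ false → step τ x xs st ≡ stackRun τ xs (x ∷ st)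
step-push [] _ = refl
step-push (y ∷ st) avoids rewrite avoids = refl

step-pop : ∀ {τ x xs y} st → Contains (x ∷ y ∷ st) τ → step τ x xs (y ∷ st) ≡ y ∷ step τ x xs st
step-pop st c rewrite c = refl

stackRun-pushAll : ∀ τ xs {rest} st → length xs + length st < length τ →
                   stackRun τ (xs ++ rest) st ≡ stackRun τ rest (xs ʳ++ st)
stackRun-pushAll τ [] st _ = refl
stackRun-pushAll τ (x ∷ xs) {rest} st fits = begin
  step τ x (xs ++ rest) st           ≡⟨ step-push st (contains-short {x ∷ st} {τ} x∷st-fits) ⟩
  stackRun τ (xs ++ rest) (x ∷ st)   ≡⟨ stackRun-pushAll τ xs (x ∷ st) (subst (_< length τ) (sym (+-suc _ _)) fits) ⟩
  stackRun τ rest (xs ʳ++ x ∷ st)    ∎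
  where
  open ≡-Reasoning
  x∷st-fits : length (x ∷ st) < length τ
  x∷st-fits = ≤-<-trans (s≤s (m≤n+m _ _)) fits

s-reverse-prefix : ∀ τ xs {rest} → length xs < length τ → s τ (reverse xs ++ rest) ≡ stackRun τ rest xs
s-reverse-prefix τ xs {rest} fits = begin
  stackRun τ (reverse xs ++ rest) []    ≡⟨ stackRun-pushAll τ (reverse xs) [] fits′ ⟩
  stackRun τ rest (reverse (reverse xs)) ≡⟨ cong (stackRun τ rest) (reverse-involutive xs) ⟩
  stackRun τ rest xs                    ∎
  where
  open ≡-Reasoning
  fits′ : length (reverse xs) + 0 < length τ
  fits′ rewrite +-identityʳ (length (reverse xs)) | length-reverse xs = fits

mutual
  stackRun-↭ : ∀ τ xs st → stackRun τ xs st ↭ st ++ xs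
  stackRun-↭ τ [] st = ↭-reflexive (sym (++-identityʳ st))
  stackRun-↭ τ (x ∷ xs) st = step-↭ τ x xs st

  step-↭ : ∀ τ x xs st → step τ x xs st ↭ st ++ x ∷ xs
  step-↭ τ x xs [] = stackRun-↭ τ xs (x ∷ [])
  step-↭ τ x xs (y ∷ st) with contains (x ∷ y ∷ st) τ
  ... | true = prep y (step-↭ τ x xs st)
  ... | false = ↭-trans (stackRun-↭ τ xs (x ∷ y ∷ st)) (↭-sym (shift x (y ∷ st) xs))

Has231 : Word → Set
Has231 w = ∃[ a ] ∃[ b ] ∃[ c ] (a ∷ b ∷ c ∷ []) ⊆ w × c < a × a < b

Has231⇒Contains231 : ∀ {w} → Has231 w → Contains w pat231
Has231⇒Contains231 (_ , _ , _ , abc⊆w , c<a , a<b) = contains⁺ abc⊆w (orderIso-231 c<a a<b)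

Has231-⊆ : ∀ {u w} → u ⊆ w → Has231 u → Has231 w
Has231-⊆ u⊆w (a , b , c , abc⊆u , c<a , a<b) = a , b , c , ⊆-trans abc⊆u u⊆w , c<a , a<b

AllPairs-⊆-pair : ∀ {R : ℕ → ℕ → Set} {w a b} → AllPairs R w → (a ∷ b ∷ []) ⊆ w → R a b
AllPairs-⊆-pair (_ ∷ pairs) (_ ∷ʳ ab⊆w) = AllPairs-⊆-pair pairs ab⊆w
AllPairs-⊆-pair (a≺w ∷ _) (refl ∷ b⊆w) = All.lookup a≺w (to∈ b⊆w)

sorted⇒avoids21 : ∀ {w} → Linked _≤_ w → ¬ Contains w pat21
sorted⇒avoids21 {w} sorted c with contains⁻ {w} {pat21} c
... | a ∷ b ∷ [] , ab⊆w , iso =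
  <⇒≱ (orderIso⇒<⇔ {a ∷ b ∷ []} {pat21} iso (there (here refl)) (here refl) .from (s≤s (s≤s z≤n)))
      (AllPairs-⊆-pair (Linked⇒AllPairs ≤-trans sorted) ab⊆w)

descent⇒contains21 : ∀ {x y} st → y < x → Contains (x ∷ y ∷ st) pat21
descent⇒contains21 st y<x = contains⁺ (refl ∷ refl ∷ minimum st) (orderIso-21 y<x)

linked-∷ : ∀ {y w} → (∀ {a} → a ∈ w → y ≤ a) → Linked _≤_ w → Linked _≤_ (y ∷ w)
linked-∷ {w = []} _ _ = [-]
linked-∷ {w = _ ∷ _} y≤w sorted = y≤w (here refl) ∷ sorted

-- st ʳ++ xs is the stack contents in input order followed by the unread input.
mutual
  stackRun21-sorted : ∀ xs st → Linked _≤_ st → ¬ Has231 (st ʳ++ xs) → Linked _≤_ (stackRun pat21 xs st)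
  stackRun21-sorted [] st sorted _ = sorted
  stackRun21-sorted (x ∷ xs) st = step21-sorted x xs st

  step21-sorted : ∀ x xs st → Linked _≤_ st → ¬ Has231 (st ʳ++ x ∷ xs) → Linked _≤_ (step pat21 x xs st)
  step21-sorted x xs [] _ no231 = stackRun21-sorted xs (x ∷ []) [-] no231
  step21-sorted x xs (y ∷ st) sorted no231 with x ≤? y
  ... | yes x≤y rewrite step-push {pat21} {x} {xs} (y ∷ st) (¬-not (sorted⇒avoids21 (x≤y ∷ sorted))) =
    stackRun21-sorted xs (x ∷ y ∷ st) (x≤y ∷ sorted) no231
  ... | no x≰y rewrite step-pop {pat21} {x} {xs} st (descent⇒contains21 st (≰⇒> x≰y)) =
    linked-∷ y≤output (step21-sorted x xs st (Linked.tail sorted) (no231 ∘ Has231-⊆ drop-y))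
    where
    drop-y : st ʳ++ x ∷ xs ⊆ st ʳ++ y ∷ x ∷ xs
    drop-y = ʳ++⁺ (⊆-refl {x = st}) (y ∷ʳ ⊆-refl)
    y≤output : ∀ {a} → a ∈ step pat21 x xs st → y ≤ a
    y≤output a∈ with ∈-++⁻ st (∈-resp-↭ (step-↭ pat21 x xs st) a∈)
    ... | inj₁ a∈st = All.lookup (AllPairs.head (Linked⇒AllPairs ≤-trans sorted)) a∈st
    ... | inj₂ (here refl) = <⇒≤ (≰⇒> x≰y)
    ... | inj₂ (there a∈xs) with y ≤? _
    ...   | yes y≤a = y≤a
    ...   | no y≰a =
      ⊥-elim (no231 (y , x , _ , ʳ++⁺ (minimum st) (refl ∷ refl ∷ from∈ a∈xs) , ≰⇒> y≰a , ≰⇒> x≰y))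

s21-sorts : ∀ w → ¬ Has231 w → WeaklyIncreasing (s pat21 w)
s21-sorts w = stackRun21-sorted w [] Linked.[]

∈⊎⊆-split : ∀ (u : Word) {w v : Word} {b : ℕ} → (b ∷ v) ⊆ u ++ w → b ∈ u ⊎ (b ∷ v) ⊆ w
∈⊎⊆-split [] bv⊆w = inj₂ bv⊆w
∈⊎⊆-split (x ∷ u) (_ ∷ʳ bv⊆) = Sum.map₁ there (∈⊎⊆-split u bv⊆)
∈⊎⊆-split (x ∷ u) (refl ∷ _) = inj₁ (here refl)

Has231-delete : ∀ u {m w} → Linked _≥_ u → All (m <_) w → Has231 (u ++ m ∷ w) → Has231 (u ++ w)
Has231-delete [] _ _ (a , b , c , _ ∷ʳ abc⊆w , c<a , a<b) = a , b , c , abc⊆w , c<a , a<b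
Has231-delete [] _ m<w (_ , _ , _ , refl ∷ bc⊆w , c<a , _) =
  ⊥-elim (<-asym c<a (All.lookup m<w (to∈ (∷ˡ⁻ bc⊆w))))
Has231-delete (x ∷ u) nonIncreasing m<w (a , b , c , _ ∷ʳ abc⊆ , c<a , a<b) =
  Has231-⊆ (x ∷ʳ ⊆-refl) (Has231-delete u (Linked.tail nonIncreasing) m<w (a , b , c , abc⊆ , c<a , a<b))
Has231-delete (x ∷ u) {m} {w} nonIncreasing m<w (_ , b , c , refl ∷ bc⊆ , c<x , x<b) =
  Sum.[ (λ b∈u → ⊥-elim (<⇒≱ x<b (All.lookup x≥u b∈u))) , bc-after-m ]′ (∈⊎⊆-split u bc⊆)
  where
  x≥u : All (x ≥_) u
  x≥u = AllPairs.head (Linked⇒AllPairs (flip ≤-trans) nonIncreasing)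
  bc-after-m : (b ∷ c ∷ []) ⊆ m ∷ w → Has231 (x ∷ u ++ w)
  bc-after-m (_ ∷ʳ bc⊆w) = x , b , c , refl ∷ ++⁺ˡ u bc⊆w , c<x , x<b
  bc-after-m (b≡m ∷ c⊆w) =
    ⊥-elim (<-asym (subst (c <_) b≡m (<-trans c<x x<b)) (All.lookup m<w (to∈ c⊆w)))

⊆-map⁻ : ∀ (f : ℕ → ℕ) {u} w → u ⊆ map f w → ∃[ v ] v ⊆ w × map f v ≡ u
⊆-map⁻ f [] [] = [] , [] , refl
⊆-map⁻ f (x ∷ w) (_ ∷ʳ u⊆) with v , v⊆w , refl ← ⊆-map⁻ f w u⊆ = v , x ∷ʳ v⊆w , refl
⊆-map⁻ f (x ∷ w) (refl ∷ u⊆) with v , v⊆w , refl ← ⊆-map⁻ f w u⊆ = x ∷ v , refl ∷ v⊆w , refl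

Has231-map⁻ : ∀ (f : ℕ → ℕ) → (∀ {x y} → f x < f y → x < y) → ∀ w → Has231 (map f w) → Has231 w
Has231-map⁻ f reflects w (_ , _ , _ , abc⊆ , c<a , a<b)
  with a ∷ b ∷ c ∷ [] , abc⊆w , refl ← ⊆-map⁻ f w abc⊆ = a , b , c , abc⊆w , reflects c<a , reflects a<b

maxW-ub : ∀ {x w} → x ∈ w → x ≤ maxW w
maxW-ub {w = y ∷ w} (here refl) = m≤m⊔n y (maxW w)
maxW-ub {w = y ∷ w} (there x∈w) = ≤-trans (maxW-ub x∈w) (m≤n⊔m y (maxW w))

maxW-lub : ∀ {B} {w} → All (_≤ B) w → maxW w ≤ B
maxW-lub All.[] = z≤n
maxW-lub (y≤B All.∷ w≤B) = ⊔-lub y≤B (maxW-lub w≤B)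

Cayley-covers : ∀ {π x i} → IsCayley π → x ∈ π → 1 ≤ i → i ≤ x → i ∈ π
Cayley-covers (_ , covers) x∈π 1≤i i≤x = covers _ 1≤i (≤-trans i≤x (maxW-ub x∈π))

cayley? : ∀ π → Dec (IsCayley π)
cayley? π = map′ fromAll toAll (All.all? (1 ≤?_) π ×-dec All.all? (_∈? π) (applyUpTo suc (maxW π)))
  where
  fromAll : All (1 ≤_) π × All (_∈ π) (applyUpTo suc (maxW π)) → IsCayley π
  fromAll (positive , covered) = All.lookup positive , λ where
    (suc j) _ j<max → applyUpTo⁻ suc (maxW π) covered j<max
  toAll : IsCayley π → All (1 ≤_) π × All (_∈ π) (applyUpTo suc (maxW π))
  toAll (positive , covers) = All.tabulate positive , applyUpTo⁺₁ suc (maxW π) (covers _ (s≤s z≤n))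

IsCayley-resp-↭ : ∀ {π π′} → π ↭ π′ → IsCayley π → IsCayley π′
IsCayley-resp-↭ {π} {π′} π↭π′ (positive , covers) =
  positive ∘ back , λ i 1≤i i≤max → ∈-resp-↭ π↭π′ (covers i 1≤i (≤-trans i≤max maxπ′≤maxπ))
  where
  back : ∀ {x} → x ∈ π′ → x ∈ π
  back = ∈-resp-↭ (↭-sym π↭π′)
  maxπ′≤maxπ : maxW π′ ≤ maxW π
  maxπ′≤maxπ = maxW-lub (All.tabulate (maxW-ub ∘ back))

IsCayley-shift : ∀ k {w} → IsCayley w → IsCayley (applyUpTo suc k ++ map (k +_) w)
IsCayley-shift k {w} (positive , covers) = positive′ , covers′
  where
  low : Word
  low = applyUpTo suc k
  positive′ : ∀ {x} → x ∈ low ++ map (k +_) w → 1 ≤ x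
  positive′ x∈ with ∈-++⁻ low x∈
  ... | inj₁ x∈low with _ , _ , refl ← ∈-applyUpTo⁻ suc x∈low = s≤s z≤n
  ... | inj₂ x∈high with y , y∈w , refl ← ∈-map⁻ (k +_) x∈high = ≤-trans (positive y∈w) (m≤n+m y k)
  bounded : ∀ {x} → x ∈ low ++ map (k +_) w → x ≤ k + maxW w
  bounded x∈ with ∈-++⁻ low x∈
  ... | inj₁ x∈low with _ , j<k , refl ← ∈-applyUpTo⁻ suc x∈low = ≤-trans j<k (m≤m+n k (maxW w))
  ... | inj₂ x∈high with y , y∈w , refl ← ∈-map⁻ (k +_) x∈high = +-monoʳ-≤ k (maxW-ub y∈w)
  covers′ : ∀ i → 1 ≤ i → i ≤ maxW (low ++ map (k +_) w) → i ∈ low ++ map (k +_) w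
  covers′ i 1≤i i≤max with i ≤? k
  covers′ (suc j) _ _ | yes i≤k = ∈-++⁺ˡ (∈-applyUpTo⁺ suc i≤k)
  ... | no i≰k = subst (_∈ low ++ map (k +_) w) (m+[n∸m]≡n (<⇒≤ k<i))
                       (∈-++⁺ʳ low (∈-map⁺ (k +_) i∸k∈w))
    where
    k<i : k < i
    k<i = ≰⇒> i≰k
    i∸k∈w : i ∸ k ∈ w
    i∸k∈w = covers (i ∸ k) (m<n⇒0<n∸m k<i) (m≤n+o⇒m∸n≤o i k (≤-trans i≤max (maxW-lub (All.tabulate bounded))))

sortable? : ∀ σ π → Dec (Sortable σ π)
sortable? σ π = linked? _≤?_ (machine σ π)

sort? : ∀ σ π → Dec (Sort σ π)
sort? σ π = cayley? π ×-dec sortable? σ π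

Sort-notClass : ∀ {σ} π τ → Sort σ π → IsCayley τ → Contains π τ → ¬ Sortable σ τ → ¬ IsClass (Sort σ)
Sort-notClass π τ sortπ cayτ π⊇τ unsortable (_ , closed) = unsortable (closed π τ sortπ cayτ π⊇τ .proj₂)

Sort-notClass-decided : ∀ σ π τ → True (sort? σ π) → True (cayley? τ) → Contains π τ →
                        False (sortable? σ τ) → ¬ IsClass (Sort σ)
Sort-notClass-decided σ π τ sortπ cayτ π⊇τ unsortable =
  Sort-notClass π τ (toWitness sortπ) (toWitness cayτ) π⊇τ (toWitnessFalse unsortable)

Sort11-notClass : ¬ IsClass (Sort (1 ∷ 1 ∷ []))
Sort11-notClass = Sort-notClass-decided _ (1 ∷ 2 ∷ 3 ∷ 2 ∷ []) pat132 _ _ refl _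

Sort21-notClass : ¬ IsClass (Sort pat21)
Sort21-notClass = Sort-notClass-decided _ (3 ∷ 4 ∷ 2 ∷ 4 ∷ 1 ∷ []) (3 ∷ 2 ∷ 4 ∷ 1 ∷ []) _ _ refl _

Sort231-notClass : ¬ IsClass (Sort pat231)
Sort231-notClass = Sort-notClass-decided _ (1 ∷ 2 ∷ 4 ∷ 2 ∷ 3 ∷ 1 ∷ []) (2 ∷ 4 ∷ 2 ∷ 3 ∷ 1 ∷ []) _ _ refl _

pat132-unsortable : ∀ σ → 3 ≤ length σ → contains pat231 σ ≡ false → ¬ Sortable σ pat132
pat132-unsortable σ 3≤|σ| 231-avoids-σ = subst (¬_ ∘ WeaklyIncreasing ∘ s pat21) (sym pushes) 231-unsorted
  where
  231-unsorted : ¬ WeaklyIncreasing (s pat21 pat231)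
  231-unsorted = toWitnessFalse {a? = linked? _≤?_ (s pat21 pat231)} _
  open ≡-Reasoning
  pushes : s σ pat132 ≡ pat231
  pushes = begin
    s σ (reverse (3 ∷ 1 ∷ []) ++ 2 ∷ [])  ≡⟨ s-reverse-prefix σ (3 ∷ 1 ∷ []) {2 ∷ []} 3≤|σ| ⟩
    step σ 2 [] (3 ∷ 1 ∷ [])              ≡⟨ step-push {σ} {2} {[]} (3 ∷ 1 ∷ []) 231-avoids-σ ⟩
    pat231                                ∎

reverse-++-↭ : ∀ (xs ys : Word) → reverse xs ++ ys ↭ ys ++ xs
reverse-++-↭ xs ys = ↭-trans (↭-++⁺ʳ ys (↭-reverse xs)) (↭-++-comm xs ys)

Sort⊈Av132 : Word → Set
Sort⊈Av132 σ = ∃[ π ] Sort σ π × Contains π pat132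

sort⊈Av132-ascent : ∀ {c d ρ} → IsCayley (c ∷ d ∷ ρ) → Avoids (d ∷ c ∷ ρ) pat231 → c < d →
                    Sort⊈Av132 (c ∷ d ∷ ρ)
sort⊈Av132-ascent {c} {d} {ρ} cay hat-avoids c<d = π , (cayley , sortable) , contains132
  where
  σ U π : Word
  σ = c ∷ d ∷ ρ
  U = map (1 +_) ρ
  π = reverse (1 ∷ U) ++ 1 + d ∷ 1 + c ∷ []
  open ≡-Reasoning

  |U| : length U ≡ length ρ
  |U| = length-map (1 +_) ρ

  descent-over-1-avoids : ∀ x → contains (suc x ∷ 1 ∷ U) σ ≡ false
  descent-over-1-avoids x = ¬-not λ c → 1+x≮1 (contains-sameLength⇒head<⇔ {w = U} {ρ} |U| c .from c<d)
    where
    1+x≮1 : ¬ suc x < 1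
    1+x≮1 (s≤s ())

  σ⁺-over-1 : Contains (1 + c ∷ 1 + d ∷ 1 ∷ U) σ
  σ⁺-over-1 = shift⊆⇒Contains 1 σ (refl ∷ refl ∷ 1 ∷ʳ ⊆-refl)

  trace : s σ π ≡ 1 + d ∷ 1 + c ∷ 1 ∷ U
  trace = begin
    s σ π                               ≡⟨ s-reverse-prefix σ (1 ∷ U) (s≤s (s≤s (≤-reflexive |U|))) ⟩
    step σ (1 + d) (1 + c ∷ []) (1 ∷ U) ≡⟨ step-push (1 ∷ U) (descent-over-1-avoids d) ⟩
    step σ (1 + c) [] (1 + d ∷ 1 ∷ U)   ≡⟨ step-pop {σ} {1 + c} {[]} (1 ∷ U) σ⁺-over-1 ⟩
    1 + d ∷ step σ (1 + c) [] (1 ∷ U)   ≡⟨ cong (1 + d ∷_) (step-push (1 ∷ U) (descent-over-1-avoids c)) ⟩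
    1 + d ∷ 1 + c ∷ 1 ∷ U               ∎

  no231 : ¬ Has231 (1 + d ∷ 1 + c ∷ 1 ∷ U)
  no231 = hat-avoids ∘ Has231⇒Contains231 ∘ Has231-map⁻ (1 +_) s≤s⁻¹ (d ∷ c ∷ ρ)
        ∘ Has231-delete (1 + d ∷ 1 + c ∷ []) (<⇒≤ (s≤s c<d) ∷ [-]) U>1
    where
    U>1 : All (1 <_) U
    U>1 = map⁺ (All.tabulate (s≤s ∘ proj₁ cay ∘ there ∘ there))

  sortable : Sortable σ π
  sortable = subst (WeaklyIncreasing ∘ s pat21) (sym trace) (s21-sorts _ no231)

  cayley : IsCayley π
  cayley = IsCayley-resp-↭ (↭-sym π↭shifted) (IsCayley-shift 1 cay)
    where
    π↭shifted : π ↭ 1 ∷ 1 + c ∷ 1 + d ∷ U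
    π↭shifted = ↭-trans (reverse-++-↭ (1 ∷ U) _)
                (↭-trans (shift 1 (1 + d ∷ 1 + c ∷ []) U) (prep 1 (swap (1 + d) (1 + c) ↭-refl)))

  contains132 : Contains π pat132
  contains132 = contains⁺ (⊆-++⁺ (reverse⁺ (refl ∷ minimum U)) ⊆-refl)
                          (orderIso-132 (s≤s (proj₁ cay (here refl))) (s≤s c<d))

sort⊈Av132-nonAscent : ∀ {c d ρ} → IsCayley (c ∷ d ∷ ρ) → Avoids (d ∷ c ∷ ρ) pat231 → d ≤ c →
                       Sort⊈Av132 (c ∷ d ∷ ρ)
sort⊈Av132-nonAscent {c} {d} {ρ} cay hat-avoids d≤c = π , (cayley , sortable) , contains132
  where
  σ R π : Word
  σ = c ∷ d ∷ ρ
  R = map (2 +_) ρ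
  π = reverse (2 + d ∷ R) ++ 1 ∷ 2 + c ∷ 2 ∷ []
  open ≡-Reasoning

  |R| : length R ≡ length ρ
  |R| = length-map (2 +_) ρ

  1≤c : 1 ≤ c
  1≤c = proj₁ cay (here refl)

  R>2 : All (2 <_) R
  R>2 = map⁺ (All.tabulate (s≤s ∘ s≤s ∘ proj₁ cay ∘ there ∘ there))

  ascent-avoids : ∀ {x y} → x < y → contains (x ∷ y ∷ R) σ ≡ false
  ascent-avoids {x} {y} x<y =
    ¬-not λ c → <⇒≱ (contains-sameLength⇒head<⇔ {x} {y} {w = R} {ρ} |R| c .to x<y) d≤c

  short-avoids : contains (2 + c ∷ R) σ ≡ false
  short-avoids = contains-short {2 + c ∷ R} {σ} (s≤s (s≤s (≤-reflexive |R|)))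

  trace : s σ π ≡ 1 ∷ 2 + d ∷ 2 ∷ 2 + c ∷ R
  trace = begin
    s σ π                                   ≡⟨ s-reverse-prefix σ (2 + d ∷ R) (s≤s (s≤s (≤-reflexive |R|))) ⟩
    step σ 1 (2 + c ∷ 2 ∷ []) (2 + d ∷ R)   ≡⟨ step-push (2 + d ∷ R) (ascent-avoids (s≤s (s≤s z≤n))) ⟩
    step σ (2 + c) (2 ∷ []) (1 ∷ 2 + d ∷ R) ≡⟨ step-pop {σ} {2 + c} {2 ∷ []} (2 + d ∷ R) σ⁺-over-1 ⟩
    1 ∷ step σ (2 + c) (2 ∷ []) (2 + d ∷ R) ≡⟨ cong (1 ∷_) (step-pop {σ} {2 + c} {2 ∷ []} R σ⁺) ⟩
    1 ∷ 2 + d ∷ step σ (2 + c) (2 ∷ []) R   ≡⟨ cong (λ out → 1 ∷ 2 + d ∷ out) (step-push R short-avoids) ⟩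
    1 ∷ 2 + d ∷ step σ 2 [] (2 + c ∷ R)     ≡⟨ cong (λ out → 1 ∷ 2 + d ∷ out) (step-push (2 + c ∷ R) 2<C-avoids) ⟩
    1 ∷ 2 + d ∷ 2 ∷ 2 + c ∷ R               ∎
    where
    σ⁺ : Contains (2 + c ∷ 2 + d ∷ R) σ
    σ⁺ = shift⊆⇒Contains 2 σ ⊆-refl
    σ⁺-over-1 : Contains (2 + c ∷ 1 ∷ 2 + d ∷ R) σ
    σ⁺-over-1 = shift⊆⇒Contains 2 σ (refl ∷ 1 ∷ʳ ⊆-refl)
    2<C-avoids : contains (2 ∷ 2 + c ∷ R) σ ≡ false
    2<C-avoids = ascent-avoids (s≤s (s≤s 1≤c))

  no231 : ¬ Has231 (1 ∷ 2 + d ∷ 2 ∷ 2 + c ∷ R)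
  no231 = hat-avoids ∘ Has231⇒Contains231 ∘ Has231-map⁻ (2 +_) (s≤s⁻¹ ∘ s≤s⁻¹) (d ∷ c ∷ ρ)
        ∘ Has231-delete (2 + d ∷ []) [-] (s≤s (s≤s 1≤c) All.∷ R>2)
        ∘ Has231-delete [] Linked.[] (1<2+ d All.∷ 1<2+ 0 All.∷ 1<2+ c All.∷ All.map <⇒≤ R>2)
    where
    1<2+ : ∀ n → 1 < 2 + n
    1<2+ _ = s≤s (s≤s z≤n)

  sortable : Sortable σ π
  sortable = subst (WeaklyIncreasing ∘ s pat21) (sym trace) (s21-sorts _ no231)

  cayley : IsCayley π
  cayley = IsCayley-resp-↭ (↭-sym π↭shifted) (IsCayley-shift 2 cay)
    where
    π↭shifted : π ↭ 1 ∷ 2 ∷ 2 + c ∷ 2 + d ∷ R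
    π↭shifted = ↭-trans (reverse-++-↭ (2 + d ∷ R) _) (prep 1 (swap (2 + c) 2 ↭-refl))

  contains132 : Contains π pat132
  contains132 = contains⁺ (++⁺ˡ (reverse (2 + d ∷ R)) ⊆-refl)
                          (orderIso-132 (s≤s (s≤s z≤n)) (s≤s (s≤s (s≤s 1≤c))))

sort⊈Av132 : ∀ {c d ρ} → IsCayley (c ∷ d ∷ ρ) → Avoids (d ∷ c ∷ ρ) pat231 → Sort⊈Av132 (c ∷ d ∷ ρ)
sort⊈Av132 {c} {d} cay hat-avoids with c <? d
... | yes c<d = sort⊈Av132-ascent cay hat-avoids c<d
... | no c≮d = sort⊈Av132-nonAscent cay hat-avoids (≮⇒≥ c≮d)

cayleyOfLength2 : List Word
cayleyOfLength2 = (1 ∷ 1 ∷ []) ∷ (1 ∷ 2 ∷ []) ∷ (2 ∷ 1 ∷ []) ∷ []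

cayley-length2 : ∀ {c d} → IsCayley (c ∷ d ∷ []) → (c ∷ d ∷ []) ∈ cayleyOfLength2
cayley-length2 {zero} (positive , _) with () ← positive (here refl)
cayley-length2 {suc _} {zero} (positive , _) with () ← positive (there (here refl))
cayley-length2 {1} {1} _ = here refl
cayley-length2 {1} {2} _ = there (here refl)
cayley-length2 {2} {1} _ = there (there (here refl))
cayley-length2 {1} {suc (suc (suc _))} cay
  with Cayley-covers cay (there (here refl)) (s≤s z≤n) (s≤s (s≤s z≤n))
... | here ()
... | there (here ())
cayley-length2 {2} {suc (suc _)} cay with Cayley-covers cay (here refl) ≤-refl (s≤s z≤n)
... | here ()
... | there (here ())
cayley-length2 {suc (suc (suc _))} {1} cay
  with Cayley-covers cay (here refl) (s≤s z≤n) (s≤s (s≤s z≤n))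
... | here ()
... | there (here ())
cayley-length2 {suc (suc (suc _))} {suc (suc _)} cay
  with Cayley-covers cay (here refl) ≤-refl (s≤s z≤n)
... | here ()
... | there (here ())

cayley-231 : ∀ {c d r} → IsCayley (c ∷ d ∷ r ∷ []) → r < c → c < d → (c ∷ d ∷ r ∷ []) ≡ pat231
cayley-231 cay@(positive , _) r<c c<d
  with Cayley-covers cay (there (there (here refl))) ≤-refl (positive (there (there (here refl))))
... | here refl = ⊥-elim (<⇒≱ r<c (positive (there (there (here refl)))))
... | there (here refl) = ⊥-elim (<⇒≱ (<-trans r<c c<d) (positive (there (there (here refl)))))
... | there (there (here refl)) with Cayley-covers cay (here refl) (s≤s z≤n) r<c
...   | there (here refl) = ⊥-elim (<⇒≱ c<d r<c)
...   | there (there (here ()))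
...   | here refl with Cayley-covers cay (there (here refl)) (s≤s z≤n) c<d
...     | there (here refl) = refl
...     | there (there (here ()))

pattern-of-231 : ∀ {c d r ρ} → IsCayley (c ∷ d ∷ r ∷ ρ) → Contains pat231 (c ∷ d ∷ r ∷ ρ) →
                 (c ∷ d ∷ r ∷ ρ) ≡ pat231
pattern-of-231 {c} {d} {r} {[]} cay σ≼231 =
  cayley-231 cay (order (there (there (here refl))) (here refl) .to (s≤s (s≤s z≤n)))
                 (order (here refl) (there (here refl)) .to (s≤s (s≤s (s≤s z≤n))))
  where
  order : ∀ {x y a b} → (x , a) ∈ zip pat231 (c ∷ d ∷ r ∷ []) → (y , b) ∈ zip pat231 (c ∷ d ∷ r ∷ []) →
          x < y ⇔ a < b
  order = orderIso⇒<⇔ {pat231} {c ∷ d ∷ r ∷ []}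
            (contains-sameLength⇒orderIso {pat231} {c ∷ d ∷ r ∷ []} refl σ≼231)
pattern-of-231 {c} {d} {r} {x ∷ ρ} _ σ≼231
  with s≤s (s≤s (s≤s ())) ← contains⇒length≤ {pat231} {c ∷ d ∷ r ∷ x ∷ ρ} σ≼231

Sort-notClass-length2 : ∀ {c d} → IsCayley (c ∷ d ∷ []) → _≢_ {A = Word} (c ∷ d ∷ []) (1 ∷ 2 ∷ []) →
                        ¬ IsClass (Sort (c ∷ d ∷ []))
Sort-notClass-length2 cay ≢12 with cayley-length2 cay
... | here refl = Sort11-notClass
... | there (here refl) = ⊥-elim (≢12 refl)
... | there (there (here refl)) = Sort21-notClass

Sort-notClass-via132 : ∀ {c d ρ} → IsCayley (c ∷ d ∷ ρ) → Avoids (d ∷ c ∷ ρ) pat231 → 3 ≤ length (c ∷ d ∷ ρ) →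
                       contains pat231 (c ∷ d ∷ ρ) ≡ false → ¬ IsClass (Sort (c ∷ d ∷ ρ))
Sort-notClass-via132 {c} {d} {ρ} cay hat-avoids 3≤|σ| 231-avoids-σ
  with π , sortπ , π⊇132 ← sort⊈Av132 {c} {d} {ρ} cay hat-avoids =
  Sort-notClass π pat132 sortπ (toWitness {a? = cayley? pat132} _) π⊇132
                (pat132-unsortable (c ∷ d ∷ ρ) 3≤|σ| 231-avoids-σ)

theorem4 : (σ : Word) → IsCayley σ → 2 ≤ length σ → σ ≢ 1 ∷ 2 ∷ [] →
    Avoids (hat σ) (2 ∷ 3 ∷ 1 ∷ []) → ¬ IsClass (Sort σ)
theorem4 (_ ∷ []) _ (s≤s ()) _ _
theorem4 (_ ∷ _ ∷ []) cay _ σ≢12 _ = Sort-notClass-length2 cay σ≢12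
theorem4 σ@(_ ∷ _ ∷ _ ∷ _) cay _ _ hat-avoids with contains pat231 σ in σ≼231
... | true = subst (¬_ ∘ IsClass ∘ Sort) (sym (pattern-of-231 cay σ≼231)) Sort231-notClass
... | false = Sort-notClass-via132 cay hat-avoids (s≤s (s≤s (s≤s z≤n))) σ≼231
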